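{- Let $R$ be a lluf subquiver of a quiver $Q$. If $\operatorname{DE}(R)$ is a facet of $\operatorname{DE}(Q)$, then $c(R)=c(Q)$ or $c(R)=c(Q)-1$; equivalently $\#\pi_0(R)=\#\pi_0(Q)$ or $\#\pi_0(R)=\#\pi_0(Q)+1$.
   Context: A quiver is a pair $Q=(Q_0,Q_1)$ with $Q_0$ finite and $Q_1\subset (Q_0\times Q_0)\setminus\{(v,v)\}$. A subquiver $R$ has $R_0\subset Q_0$, $R_1\subset Q_1$; it is lluf if $R_0=Q_0$. $\varepsilon_{(v,w)}=\kappa_{\{v\}}-\kappa_{\{w\}}\in\mathbb{R}^{Q_0}$ with $\kappa_{\{v\}}$ the indicator of $v$; $\operatorname{DE}(Q)=\operatorname{conv}\{\varepsilon_{(v,w)}\mid(v,w)\in Q_1\}$ and similarly $\operatorname{DE}(R)$. $\pi_0$ denotes the set of connected components (connectivity via undirected walks) and $c(Q)=\#Q_0-\#\pi_0(Q)$.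
   Formalization: The polytopes DE(Q) and DE(R), with their supporting hyperplanes, faces and dimensions, are taken in ℚ^Q₀ rather than $\mathbb{R}^{Q_0}$. -}

module Defs where

open import Data.Nat using (ℕ; zero; suc)
open import Data.Fin using (Fin; _≟_) renaming (zero to fzero; suc to fsuc)
open import Data.Bool using (if_then_else_)
open import Data.Product using (Σ; Σ-syntax; ∃; _×_; _,_; proj₁; proj₂)
open import Data.List using (List; length; lookup)
open import Data.List.Relation.Unary.All using (All)
open import Data.List.Membership.Propositional using (_∈_)
open import Data.Rational using (ℚ; 0ℚ; 1ℚ; _+_; _*_; _-_; _≤_)
open import Relation.Binary.PropositionalEquality using (_≡_; _≢_)
open import Relation.Nullary using (¬_)
open import Relation.Nullary.Decidable using (⌊_⌋)

Arrow : ℕ → Set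
Arrow n = Fin n × Fin n

record Quiver (n : ℕ) : Set where
  field
    arrows  : List (Arrow n)
    noLoops : All (λ e → proj₁ e ≢ proj₂ e) arrows
open Quiver public

IsLlufSubquiver : ∀ {n} → Quiver n → Quiver n → Set
IsLlufSubquiver R Q = ∀ {e} → e ∈ arrows R → e ∈ arrows Q

Vecℚ : ℕ → Set
Vecℚ n = Fin n → ℚ

sumF : ∀ {m} → (Fin m → ℚ) → ℚ
sumF {zero}  f = 0ℚ
sumF {suc m} f = f fzero + sumF (λ i → f (fsuc i))

dot : ∀ {n} → Vecℚ n → Vecℚ n → ℚ
dot a x = sumF (λ j → a j * x j)

κ : ∀ {n} → Fin n → Vecℚ n
κ v i = if ⌊ i ≟ v ⌋ then 1ℚ else 0ℚ

ε : ∀ {n} → Arrow n → Vecℚ n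
ε (v , w) i = κ v i - κ w i

Subsetℚ : ℕ → Set₁
Subsetℚ n = Vecℚ n → Set

conv : ∀ {n} → List (Vecℚ n) → Subsetℚ n
conv ps x = Σ[ c ∈ (Fin (length ps) → ℚ) ]
  ((∀ i → 0ℚ ≤ c i) × (sumF c ≡ 1ℚ) ×
   (∀ j → x j ≡ sumF (λ i → c i * lookup ps i j)))

DE : ∀ {n} → Quiver n → Subsetℚ n
DE Q = conv (Data.List.map ε (arrows Q))

AffInd : ∀ {n k} → (Fin k → Vecℚ n) → Set
AffInd {n} {k} xs = (μ : Fin k → ℚ) → sumF μ ≡ 0ℚ →
  (∀ j → sumF (λ i → μ i * xs i j) ≡ 0ℚ) → ∀ i → μ i ≡ 0ℚ

-- DimPlusOne S k : the maximal number of affinely independent points of S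
-- is k, i.e. dim S = k - 1 (with dim ∅ = -1).
DimPlusOne : ∀ {n} → Subsetℚ n → ℕ → Set
DimPlusOne {n} S k =
  (Σ[ xs ∈ (Fin k → Vecℚ n) ] ((∀ i → S (xs i)) × AffInd xs)) ×
  ((xs : Fin (suc k) → Vecℚ n) → (∀ i → S (xs i)) → ¬ AffInd xs)

IsFace : ∀ {n} → Subsetℚ n → Subsetℚ n → Set
IsFace {n} F P = Σ[ a ∈ Vecℚ n ] Σ[ b ∈ ℚ ]
  ((∀ x → P x → dot a x ≤ b) ×
   (∀ x → F x → P x × dot a x ≡ b) ×
   (∀ x → P x → dot a x ≡ b → F x))

IsFacet : ∀ {n} → Subsetℚ n → Subsetℚ n → Set
IsFacet F P = IsFace F P × Σ[ k ∈ ℕ ] (DimPlusOne F k × DimPlusOne P (suc k))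

data Connected {n} (Q : Quiver n) : Fin n → Fin n → Set where
  here : ∀ {v} → Connected Q v v
  fwd  : ∀ {v w u} → (v , w) ∈ arrows Q → Connected Q w u → Connected Q v u
  bwd  : ∀ {v w u} → (w , v) ∈ arrows Q → Connected Q w u → Connected Q v u

-- #π₀(Q) = k : there is a surjection Fin n → Fin k whose fibres are
-- exactly the connected components (i.e. π₀(Q) ≅ Fin k).
NumComponents : ∀ {n} → Quiver n → ℕ → Set
NumComponents {n} Q k = Σ[ f ∈ (Fin n → Fin k) ]
  ((∀ (c : Fin k) → ∃ λ v → f v ≡ c) ×
   (∀ v w → f v ≡ f w → Connected Q v w) ×
   (∀ v w → Connected Q v w → f v ≡ f w))

-- Components of R refine those of Q, so #π₀(Q) ≤ #π₀(R).  Conversely, every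
-- functional constant on the components of R vanishes on DE(R).  If R had two
-- more components than Q, there would be arrows e₁, e₂ of Q and two such
-- functionals (indicators of components of R, and of the coarser partition
-- in which the two components met by e₁ are glued) separating ε(e₁), ε(e₂)
-- from DE(R) and from each other.  Adding ε(e₁), ε(e₂) to dim DE(R) + 1
-- affinely independent points of DE(R) would then give dim DE(Q) + 2 affinely
-- independent points of DE(Q).
module Submission where

open import Defs
open import Data.Nat using (ℕ; zero; suc; _≤_; _<_; s≤s⁻¹)
open import Data.Nat.Properties
  using (≤-trans; ≤-antisym; n≤1+n; ≮⇒≥; m≤n⇒m<n∨m≡n; m<1+n⇒m≤n)
open import Data.Fin using (Fin; _≟_; punchIn) renaming (zero to fzero; suc to fsuc)
open import Data.Fin.Properties
  using (pigeonhole; injective⇒≤; <⇒≢; suc-injective; punchIn-injective; punchInᵢ≢i)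
open import Data.Vec.Functional using (_∷_)
open import Data.Product using (Σ; ∃; _×_; _,_; proj₁; proj₂)
open import Data.Sum using (_⊎_; inj₁; inj₂)
open import Data.Empty using (⊥; ⊥-elim)
open import Data.List using (lookup; map)
open import Data.List.Relation.Unary.Any using (index)
open import Data.List.Relation.Unary.Any.Properties using (lookup-index)
open import Data.List.Membership.Propositional using (_∈_)
open import Data.List.Membership.Propositional.Properties using (∈-map⁺; ∈-map⁻; ∈-lookup)
open import Data.Rational using (ℚ; 0ℚ; 1ℚ; _+_; _*_; _-_) renaming (_≤_ to _≤ℚ_)
open import Data.Rational.Properties
  using ( *-zeroˡ; *-zeroʳ; *-identityˡ; *-identityʳ; *-distribˡ-+
        ; +-identityˡ; +-identityʳ; +-inverseʳ; ≤-refl; nonNegative⁻¹)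
open import Data.Rational.Solver using (module +-*-Solver)
open import Function using (_∘_)
open import Function.Definitions using (Injective)
open import Relation.Binary.PropositionalEquality
  using (_≡_; _≢_; refl; sym; trans; cong; cong₂; subst; module ≡-Reasoning)
open import Relation.Nullary using (Dec; yes; no)

open +-*-Solver

private
  variable
    n k m K : ℕ

sumF-cong : {f g : Fin m → ℚ} → (∀ i → f i ≡ g i) → sumF f ≡ sumF g
sumF-cong {zero}  f≡g = refl
sumF-cong {suc m} f≡g = cong₂ _+_ (f≡g fzero) (sumF-cong (f≡g ∘ fsuc))

sumF-vanishes : {f : Fin m → ℚ} → (∀ i → f i ≡ 0ℚ) → sumF f ≡ 0ℚ
sumF-vanishes {zero}  f≡0 = refl
sumF-vanishes {suc m} f≡0 =
  trans (cong₂ _+_ (f≡0 fzero) (sumF-vanishes (f≡0 ∘ fsuc))) (+-identityʳ 0ℚ)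

sumF-+ : (f g : Fin m → ℚ) → sumF (λ i → f i + g i) ≡ sumF f + sumF g
sumF-+ {zero}  f g = refl
sumF-+ {suc m} f g = begin
  (f fzero + g fzero) + sumF (λ i → f (fsuc i) + g (fsuc i))
    ≡⟨ cong (f fzero + g fzero +_) (sumF-+ (f ∘ fsuc) (g ∘ fsuc)) ⟩
  (f fzero + g fzero) + (sumF (f ∘ fsuc) + sumF (g ∘ fsuc))
    ≡⟨ solve 4 (λ a b c d → (a :+ b) :+ (c :+ d) := (a :+ c) :+ (b :+ d)) refl
         (f fzero) (g fzero) (sumF (f ∘ fsuc)) (sumF (g ∘ fsuc)) ⟩
  sumF f + sumF g ∎
  where open ≡-Reasoning

sumF-- : (f g : Fin m → ℚ) → sumF (λ i → f i - g i) ≡ sumF f - sumF g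
sumF-- {zero}  f g = refl
sumF-- {suc m} f g = begin
  (f fzero - g fzero) + sumF (λ i → f (fsuc i) - g (fsuc i))
    ≡⟨ cong (f fzero - g fzero +_) (sumF-- (f ∘ fsuc) (g ∘ fsuc)) ⟩
  (f fzero - g fzero) + (sumF (f ∘ fsuc) - sumF (g ∘ fsuc))
    ≡⟨ solve 4 (λ a b c d → (a :- b) :+ (c :- d) := (a :+ c) :- (b :+ d)) refl
         (f fzero) (g fzero) (sumF (f ∘ fsuc)) (sumF (g ∘ fsuc)) ⟩
  sumF f - sumF g ∎
  where open ≡-Reasoning

sumF-*ˡ : (c : ℚ) (f : Fin m → ℚ) → sumF (λ i → c * f i) ≡ c * sumF f
sumF-*ˡ {zero}  c f = sym (*-zeroʳ c)
sumF-*ˡ {suc m} c f =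
  trans (cong (c * f fzero +_) (sumF-*ˡ c (f ∘ fsuc))) (sym (*-distribˡ-+ c _ _))

sumF-comm : (f : Fin m → Fin k → ℚ) →
  sumF (λ i → sumF (f i)) ≡ sumF (λ j → sumF (λ i → f i j))
sumF-comm {zero} {k} f = sym (sumF-vanishes {m = k} (λ _ → refl))
sumF-comm {suc m}     f =
  trans (cong (sumF (f fzero) +_) (sumF-comm (f ∘ fsuc)))
        (sym (sumF-+ (f fzero) (λ j → sumF (λ i → f (fsuc i) j))))

κ-same : (v : Fin n) → κ v v ≡ 1ℚ
κ-same v with v ≟ v
... | yes _  = refl
... | no v≢v = ⊥-elim (v≢v refl)

κ-diff : {v i : Fin n} → i ≢ v → κ v i ≡ 0ℚ
κ-diff {v = v} {i} i≢v with i ≟ v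
... | yes i≡v = ⊥-elim (i≢v i≡v)
... | no _    = refl

κ-suc : (v i : Fin n) → κ (fsuc v) (fsuc i) ≡ κ v i
κ-suc v i = by-cases (i ≟ v)
  where
  by-cases : Dec (i ≡ v) → κ (fsuc v) (fsuc i) ≡ κ v i
  by-cases (yes refl) = trans (κ-same (fsuc v)) (sym (κ-same v))
  by-cases (no i≢v)   = trans (κ-diff (i≢v ∘ suc-injective)) (sym (κ-diff i≢v))

0≤κ : (v i : Fin n) → 0ℚ ≤ℚ κ v i
0≤κ v i = by-cases (i ≟ v)
  where
  by-cases : Dec (i ≡ v) → 0ℚ ≤ℚ κ v i
  by-cases (yes refl) = subst (0ℚ ≤ℚ_) (sym (κ-same v)) (nonNegative⁻¹ 1ℚ)
  by-cases (no i≢v)   = subst (0ℚ ≤ℚ_) (sym (κ-diff i≢v)) ≤-refl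

sumF-κ : (v : Fin n) (f : Fin n → ℚ) → sumF (λ j → κ v j * f j) ≡ f v
sumF-κ fzero f = begin
  1ℚ * f fzero + sumF (λ i → 0ℚ * f (fsuc i))
    ≡⟨ cong₂ _+_ (*-identityˡ (f fzero)) (sumF-vanishes (λ i → *-zeroˡ (f (fsuc i)))) ⟩
  f fzero + 0ℚ
    ≡⟨ +-identityʳ _ ⟩
  f fzero ∎
  where open ≡-Reasoning
sumF-κ (fsuc v) f = begin
  0ℚ * f fzero + sumF (λ i → κ (fsuc v) (fsuc i) * f (fsuc i))
    ≡⟨ cong₂ _+_ (*-zeroˡ (f fzero)) (sumF-cong (λ i → cong (_* f (fsuc i)) (κ-suc v i))) ⟩
  0ℚ + sumF (λ i → κ v i * f (fsuc i))
    ≡⟨ trans (+-identityˡ _) (sumF-κ v (f ∘ fsuc)) ⟩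
  f (fsuc v) ∎
  where open ≡-Reasoning

combination : (Fin m → ℚ) → (Fin m → Vecℚ n) → Vecℚ n
combination μ xs j = sumF (λ i → μ i * xs i j)

dot-combination : (s : Vecℚ n) (μ : Fin m → ℚ) (xs : Fin m → Vecℚ n) →
  dot s (combination μ xs) ≡ sumF (λ i → μ i * dot s (xs i))
dot-combination s μ xs = begin
  sumF (λ j → s j * sumF (λ i → μ i * xs i j))
    ≡⟨ sumF-cong (λ j → sym (sumF-*ˡ (s j) (λ i → μ i * xs i j))) ⟩
  sumF (λ j → sumF (λ i → s j * (μ i * xs i j)))
    ≡⟨ sumF-comm (λ j i → s j * (μ i * xs i j)) ⟩
  sumF (λ i → sumF (λ j → s j * (μ i * xs i j)))
    ≡⟨ sumF-cong (λ i → sumF-cong (λ j →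
         solve 3 (λ a b c → a :* (b :* c) := b :* (a :* c)) refl (s j) (μ i) (xs i j))) ⟩
  sumF (λ i → sumF (λ j → μ i * (s j * xs i j)))
    ≡⟨ sumF-cong (λ i → sumF-*ˡ (μ i) (λ j → s j * xs i j)) ⟩
  sumF (λ i → μ i * dot s (xs i)) ∎
  where open ≡-Reasoning

dot-vanishes : (s : Vecℚ n) {x : Vecℚ n} → (∀ j → x j ≡ 0ℚ) → dot s x ≡ 0ℚ
dot-vanishes s x≡0 = sumF-vanishes (λ j → trans (cong (s j *_) (x≡0 j)) (*-zeroʳ (s j)))

dot-ε : (s : Vecℚ n) (a b : Fin n) → dot s (ε (a , b)) ≡ s a - s b
dot-ε s a b = begin
  sumF (λ j → s j * (κ a j - κ b j))
    ≡⟨ sumF-cong (λ j →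
         solve 3 (λ x y z → x :* (y :- z) := y :* x :- z :* x) refl (s j) (κ a j) (κ b j)) ⟩
  sumF (λ j → κ a j * s j - κ b j * s j)
    ≡⟨ sumF-- (λ j → κ a j * s j) (λ j → κ b j * s j) ⟩
  sumF (λ j → κ a j * s j) - sumF (λ j → κ b j * s j)
    ≡⟨ cong₂ _-_ (sumF-κ a s) (sumF-κ b s) ⟩
  s a - s b ∎
  where open ≡-Reasoning

-- A linear functional vanishing on ys but not on x detects the coefficient
-- of x in any affine dependence of x ∷ ys.
AffInd-∷ : {x : Vecℚ n} {ys : Fin k → Vecℚ n} (s : Vecℚ n) →
  (∀ i → dot s (ys i) ≡ 0ℚ) → dot s x ≡ 1ℚ → AffInd ys → AffInd (x ∷ ys)
AffInd-∷ {x = x} {ys} s s-ys s-x ys-indep μ Σμ≡0 comb≡0 = μ≡0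
  where
  open ≡-Reasoning
  μ₀ : ℚ
  μ₀ = μ fzero
  ν : Fin _ → ℚ
  ν = μ ∘ fsuc
  μ₀≡0 : μ₀ ≡ 0ℚ
  μ₀≡0 = begin
    μ₀
      ≡⟨ solve 1 (λ a → a := a :* con 1ℚ :+ con 0ℚ) refl μ₀ ⟩
    μ₀ * 1ℚ + 0ℚ
      ≡⟨ cong₂ (λ a b → μ₀ * a + b) (sym s-x)
           (sym (sumF-vanishes (λ i → trans (cong (ν i *_) (s-ys i)) (*-zeroʳ (ν i))))) ⟩
    sumF (λ i → μ i * dot s ((x ∷ ys) i))
      ≡⟨ sym (dot-combination s μ (x ∷ ys)) ⟩
    dot s (combination μ (x ∷ ys))
      ≡⟨ dot-vanishes s comb≡0 ⟩
    0ℚ ∎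
  without-head : (a c : ℚ) → μ₀ * a + c ≡ 0ℚ → c ≡ 0ℚ
  without-head a c eq = begin
    c            ≡⟨ sym (+-identityˡ c) ⟩
    0ℚ + c       ≡⟨ cong (_+ c) (sym (*-zeroˡ a)) ⟩
    0ℚ * a + c   ≡⟨ cong (λ z → z * a + c) (sym μ₀≡0) ⟩
    μ₀ * a + c   ≡⟨ eq ⟩
    0ℚ           ∎
  μ≡0 : ∀ i → μ i ≡ 0ℚ
  μ≡0 fzero    = μ₀≡0
  μ≡0 (fsuc i) = ys-indep ν
    (without-head 1ℚ (sumF ν) (trans (cong (_+ sumF ν) (*-identityʳ μ₀)) Σμ≡0))
    (λ j → without-head (x j) _ (comb≡0 j)) i

ε∈DE : (Q : Quiver n) {e : Arrow n} → e ∈ arrows Q → DE Q (ε e)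
ε∈DE Q {e} e∈Q =
  κ i , 0≤κ i ,
  trans (sumF-cong (λ j → sym (*-identityʳ (κ i j)))) (sumF-κ i _) ,
  λ j → sym (trans (sumF-κ i _) (cong (λ y → y j) (sym (lookup-index p))))
  where
  p : ε e ∈ map ε (arrows Q)
  p = ∈-map⁺ ε e∈Q
  i : Fin _
  i = index p

RespectsArrows : {A : Set} → Quiver n → (Fin n → A) → Set
RespectsArrows R f = ∀ {a b} → (a , b) ∈ arrows R → f a ≡ f b

DE-annihilated : (R : Quiver n) {s : Vecℚ n} → RespectsArrows R s →
  ∀ {y} → DE R y → dot s y ≡ 0ℚ
DE-annihilated R {s} s-resp {y} (c , _ , _ , y≡comb) = begin
  dot s y
    ≡⟨ sumF-cong (λ j → cong (s j *_) (y≡comb j)) ⟩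
  dot s (combination c points)
    ≡⟨ dot-combination s c points ⟩
  sumF (λ i → c i * dot s (points i))
    ≡⟨ sumF-vanishes (λ i → trans (cong (c i *_) (vanishes-on-points i)) (*-zeroʳ (c i))) ⟩
  0ℚ ∎
  where
  open ≡-Reasoning
  points : Fin _ → Vecℚ _
  points = lookup (map ε (arrows R))
  vanishes-on-points : ∀ i → dot s (points i) ≡ 0ℚ
  vanishes-on-points i with ∈-map⁻ ε (∈-lookup i)
  ... | (a , b) , ab∈R , pᵢ≡εab =
    trans (cong (dot s) pᵢ≡εab)
          (trans (dot-ε s a b) (trans (cong (_- s b) (s-resp ab∈R)) (+-inverseʳ (s b))))

indicator-crossing : (f : Fin n → Fin K) {a b : Fin n} → f a ≢ f b →
  dot (κ (f a) ∘ f) (ε (a , b)) ≡ 1ℚ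
indicator-crossing f {a} {b} fa≢fb =
  trans (dot-ε (κ (f a) ∘ f) a b) (cong₂ _-_ (κ-same (f a)) (κ-diff (fa≢fb ∘ sym)))

indicator-level : (f : Fin n → Fin K) (c : Fin K) {a b : Fin n} → f a ≡ f b →
  dot (κ c ∘ f) (ε (a , b)) ≡ 0ℚ
indicator-level f c {a} {b} fa≡fb =
  trans (dot-ε (κ c ∘ f) a b)
        (trans (cong (λ z → κ c z - κ c (f b)) fa≡fb) (+-inverseʳ (κ c (f b))))

Connected-mono : {Q R : Quiver n} → IsLlufSubquiver R Q →
  ∀ {v w} → Connected R v w → Connected Q v w
Connected-mono R⊆Q here         = here
Connected-mono R⊆Q (fwd vw∈R c) = fwd (R⊆Q vw∈R) (Connected-mono R⊆Q c)
Connected-mono R⊆Q (bwd wv∈R c) = bwd (R⊆Q wv∈R) (Connected-mono R⊆Q c)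

CrossingArrow : Quiver n → (Fin n → Fin K) → Set
CrossingArrow Q f = Σ (Arrow _) λ e → e ∈ arrows Q × f (proj₁ e) ≢ f (proj₂ e)

Connected⇒CrossingArrow : (Q : Quiver n) (f : Fin n → Fin K) →
  ∀ {v w} → Connected Q v w → f v ≢ f w → CrossingArrow Q f
Connected⇒CrossingArrow Q f here fv≢fv = ⊥-elim (fv≢fv refl)
Connected⇒CrossingArrow Q f {v} (fwd {w = u} vu∈Q c) fv≢fw with f v ≟ f u
... | yes fv≡fu = Connected⇒CrossingArrow Q f c (fv≢fw ∘ trans fv≡fu)
... | no fv≢fu  = (v , u) , vu∈Q , fv≢fu
Connected⇒CrossingArrow Q f {v} (bwd {w = u} uv∈Q c) fv≢fw with f v ≟ f u
... | yes fv≡fu = Connected⇒CrossingArrow Q f c (fv≢fw ∘ trans fv≡fu)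
... | no fv≢fu  = (u , v) , uv∈Q , fv≢fu ∘ sym

NumComponents-mono : {Q R : Quiver n} {kQ kR : ℕ} → IsLlufSubquiver R Q →
  NumComponents Q kQ → NumComponents R kR → kQ ≤ kR
NumComponents-mono R⊆Q (fQ , fQ-onto , _ , fQ-resp) (fR , _ , fR-conn , _) =
  injective⇒≤ {f = fR ∘ rep} λ {c} {c'} eq →
    trans (sym (proj₂ (fQ-onto c)))
          (trans (fQ-resp _ _ (Connected-mono R⊆Q (fR-conn _ _ eq))) (proj₂ (fQ-onto c')))
  where
  rep : Fin _ → Fin _
  rep c = proj₁ (fQ-onto c)

-- By pigeonhole two of the vertices r i lie in one component of Q; a walk
-- between them must cross f.
pigeonhole-crossing : {Q : Quiver n} {kQ K' : ℕ} → NumComponents Q kQ →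
  (f : Fin n → Fin K) (r : Fin K' → Fin n) → Injective _≡_ _≡_ (f ∘ r) → kQ < K' →
  CrossingArrow Q f
pigeonhole-crossing {Q = Q} (fQ , _ , fQ-conn , _) f r f∘r-inj kQ<K'
  with i , j , i<j , fQri≡fQrj ← pigeonhole kQ<K' (fQ ∘ r) =
  Connected⇒CrossingArrow Q f (fQ-conn _ _ fQri≡fQrj) (<⇒≢ i<j ∘ f∘r-inj)

identify : Fin K → Fin K → Fin K → Fin K
identify b a x with x ≟ b
... | yes _ = a
... | no _  = x

identify-≡ : (b a : Fin K) → identify b a b ≡ a
identify-≡ b a with b ≟ b
... | yes _  = refl
... | no b≢b = ⊥-elim (b≢b refl)

identify-≢ : (b a : Fin K) {x : Fin K} → x ≢ b → identify b a x ≡ x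
identify-≢ b a {x} x≢b with x ≟ b
... | yes x≡b = ⊥-elim (x≢b x≡b)
... | no _    = refl

-- Arrows e₁, e₂ of Q whose ε are linearly independent modulo functionals
-- constant on the components of R.
record IndependentArrows (Q R : Quiver n) : Set where
  field
    e₁ e₂       : Arrow n
    e₁∈Q        : e₁ ∈ arrows Q
    e₂∈Q        : e₂ ∈ arrows Q
    s₁ s₂       : Vecℚ n
    s₁-respects : RespectsArrows R s₁
    s₂-respects : RespectsArrows R s₂
    s₂-e₁       : dot s₂ (ε e₁) ≡ 1ℚ
    s₁-e₁       : dot s₁ (ε e₁) ≡ 0ℚ
    s₁-e₂       : dot s₁ (ε e₂) ≡ 1ℚ

onto-crossing : {Q : Quiver n} {kQ : ℕ} → NumComponents Q kQ →
  (f : Fin n → Fin K) → (∀ c → ∃ λ v → f v ≡ c) → kQ < K → CrossingArrow Q f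
onto-crossing ncQ f f-onto =
  pigeonhole-crossing ncQ f (proj₁ ∘ f-onto)
    λ {c} {c'} eq → trans (sym (proj₂ (f-onto c))) (trans eq (proj₂ (f-onto c')))

-- Gluing two values of an onto map leaves K distinct values, attained at
-- representatives of the classes punchIn b i.
glued-onto-crossing : {Q : Quiver n} {kQ : ℕ} → NumComponents Q kQ →
  (f : Fin n → Fin (suc K)) → (∀ c → ∃ λ v → f v ≡ c) → kQ < K →
  (b a : Fin (suc K)) → CrossingArrow Q (identify b a ∘ f)
glued-onto-crossing ncQ f f-onto kQ<K b a =
  pigeonhole-crossing ncQ (identify b a ∘ f) (rep ∘ punchIn b)
    (λ {i} {j} eq → punchIn-injective b i j (trans (sym (glued-rep i)) (trans eq (glued-rep j))))
    kQ<K
  where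
  rep : Fin (suc _) → Fin _
  rep c = proj₁ (f-onto c)
  glued-rep : ∀ i → identify b a (f (rep (punchIn b i))) ≡ punchIn b i
  glued-rep i = trans (cong (identify b a) (proj₂ (f-onto _))) (identify-≢ b a (punchInᵢ≢i b i))

crossings⇒IndependentArrows : {Q R : Quiver n} (f : Fin n → Fin K) →
  RespectsArrows R f → ∀ {u₁ w₁} → (u₁ , w₁) ∈ arrows Q → f u₁ ≢ f w₁ →
  CrossingArrow Q (identify (f w₁) (f u₁) ∘ f) → IndependentArrows Q R
crossings⇒IndependentArrows f f-respects {u₁} {w₁} e₁∈Q fu₁≢fw₁
  ((u₂ , w₂) , e₂∈Q , gu₂≢gw₂) = record
  { e₁ = u₁ , w₁ ; e₂ = u₂ , w₂ ; e₁∈Q = e₁∈Q ; e₂∈Q = e₂∈Q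
  ; s₁ = κ (g u₂) ∘ g
  ; s₂ = κ (f u₁) ∘ f
  ; s₁-respects = cong (κ (g u₂) ∘ identify (f w₁) (f u₁)) ∘ f-respects
  ; s₂-respects = cong (κ (f u₁)) ∘ f-respects
  ; s₂-e₁ = indicator-crossing f fu₁≢fw₁
  ; s₁-e₁ = indicator-level g _
      (trans (identify-≢ (f w₁) (f u₁) fu₁≢fw₁) (sym (identify-≡ (f w₁) (f u₁))))
  ; s₁-e₂ = indicator-crossing g gu₂≢gw₂
  }
  where
  g : Fin _ → Fin _
  g = identify (f w₁) (f u₁) ∘ f

surplus-components⇒IndependentArrows : {Q R : Quiver n} {kQ kR : ℕ} →
  NumComponents Q kQ → NumComponents R kR → suc kQ < kR → IndependentArrows Q R
surplus-components⇒IndependentArrows {kR = suc _} ncQ (fR , fR-onto , _ , fR-resp) 1+kQ<kR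
  with (u₁ , w₁) , e₁∈Q , fRu₁≢fRw₁ ← onto-crossing ncQ fR fR-onto (≤-trans (n≤1+n _) 1+kQ<kR) =
  crossings⇒IndependentArrows fR (λ ab∈R → fR-resp _ _ (fwd ab∈R here)) e₁∈Q fRu₁≢fRw₁
    (glued-onto-crossing ncQ fR fR-onto (s≤s⁻¹ 1+kQ<kR) (fR w₁) (fR u₁))

IndependentArrows⇒AffInd : {Q R : Quiver n} (ind : IndependentArrows Q R) →
  let open IndependentArrows ind in
  {ys : Fin k → Vecℚ n} → (∀ i → DE R (ys i)) → AffInd ys → AffInd (ε e₂ ∷ ε e₁ ∷ ys)
IndependentArrows⇒AffInd {R = R} ind {ys} ys∈DE-R ys-indep =
  AffInd-∷ s₁ s₁-vanishes s₁-e₂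
    (AffInd-∷ s₂ (λ i → DE-annihilated R s₂-respects (ys∈DE-R i)) s₂-e₁ ys-indep)
  where
  open IndependentArrows ind
  s₁-vanishes : ∀ i → dot s₁ ((ε e₁ ∷ ys) i) ≡ 0ℚ
  s₁-vanishes fzero    = s₁-e₁
  s₁-vanishes (fsuc i) = DE-annihilated R s₁-respects (ys∈DE-R i)

m≤n≤1+m⇒n≡m∨n≡1+m : ∀ {m n} → m ≤ n → n ≤ suc m → n ≡ m ⊎ n ≡ suc m
m≤n≤1+m⇒n≡m∨n≡1+m m≤n n≤1+m with m≤n⇒m<n∨m≡n n≤1+m
... | inj₁ n<1+m = inj₁ (≤-antisym (m<1+n⇒m≤n n<1+m) m≤n)
... | inj₂ n≡1+m = inj₂ n≡1+m

lemma4p1 : ∀ {n : ℕ} (Q R : Quiver n) → IsLlufSubquiver R Q →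
    IsFacet (DE R) (DE Q) →
    ∀ (kQ kR : ℕ) → NumComponents Q kQ → NumComponents R kR →
    kR ≡ kQ ⊎ kR ≡ suc kQ
lemma4p1 Q R R⊆Q ((_ , _ , _ , DE-R⊆DE-Q , _) , _ , ((ys , ys∈DE-R , ys-indep) , _) , (_ , DE-Q-bound))
         kQ kR ncQ ncR =
  m≤n≤1+m⇒n≡m∨n≡1+m (NumComponents-mono R⊆Q ncQ ncR) (≮⇒≥ two-more-components-impossible)
  where
  two-more-components-impossible : suc kQ < kR → ⊥
  two-more-components-impossible 1+kQ<kR =
    DE-Q-bound (ε e₂ ∷ ε e₁ ∷ ys) in-DE-Q (IndependentArrows⇒AffInd ind ys∈DE-R ys-indep)
    where
    ind : IndependentArrows Q R
    ind = surplus-components⇒IndependentArrows ncQ ncR 1+kQ<kR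
    open IndependentArrows ind
    in-DE-Q : ∀ i → DE Q ((ε e₂ ∷ ε e₁ ∷ ys) i)
    in-DE-Q fzero           = ε∈DE Q e₂∈Q
    in-DE-Q (fsuc fzero)    = ε∈DE Q e₁∈Q
    in-DE-Q (fsuc (fsuc i)) = proj₁ (DE-R⊆DE-Q (ys i) (ys∈DE-R i))
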